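{- The proof system $\mathsf{C}(\ast,\mathrel{ -\!\!\ast})$ is sound for quantifier-free separation logic $\mathrm{SL}(\ast,\mathrel{ -\!\!\ast})$: every formula derivable in $\mathsf{C}(\ast,\mathrel{ -\!\!\ast})$ is valid.
   Context: Syntax of $\mathrm{SL}(\ast,\mathrel{ -\!\!\ast})$: fix a countably infinite set $\mathrm{PVAR}$ of program variables and a countably infinite set $\mathrm{LOC}$ of locations. Formulae are given by $\varphi ::= x = y \mid x \hookrightarrow y \mid \mathrm{emp} \mid \neg\varphi \mid \varphi\wedge\varphi \mid \varphi \ast \varphi \mid \varphi \mathrel{ -\!\!\ast} \varphi$ with $x,y\in\mathrm{PVAR}$; $\vee,\Rightarrow,\Leftrightarrow$ are the usual abbreviations. Semantics: a memory state is a pair $(s,h)$ with $s:\mathrm{PVAR}\to\mathrm{LOC}$ and $h$ a partial function $\mathrm{LOC}\to\mathrm{LOC}$ with finite domain $\mathrm{dom}(h)$. Heaps $h_1,h_2$ are disjoint if $\mathrm{dom}(h_1)\cap\mathrm{dom}(h_2)=\emptyset$, and then $h_1+h_2$ is their union. $(s,h)\models x=y$ iff $s(x)=s(y)$; $(s,h)\models\mathrm{emp}$ iff $\mathrm{dom}(h)=\emptyset$; $(s,h)\models x\hookrightarrow y$ iff $s(x)\in\mathrm{dom}(h)$ and $h(s(x))=s(y)$; Boolean connectives as usual; $(s,h)\models\varphi_1\ast\varphi_2$ iff there are disjoint $h_1,h_2$ with $h=h_1+h_2$, $(s,h_1)\models\varphi_1$ and $(s,h_2)\models\varphi_2$; $(s,h)\models\varphi_1\mathrel{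 -\!\!\ast}\varphi_2$ iff for every heap $h_1$ disjoint from $h$ with $(s,h_1)\models\varphi_1$, $(s,h+h_1)\models\varphi_2$. A formula is valid if every memory state satisfies it. Abbreviations: $\bot := \neg(x=x)$, $\top:=\neg\bot$; $\varphi \mathrel{ -\!\!\circledast} \psi := \neg(\varphi\mathrel{ -\!\!\ast}\neg\psi)$; $\mathrm{alloc}(x) := (x\hookrightarrow x)\mathrel{ -\!\!\ast}\bot$ (so $(s,h)\models\mathrm{alloc}(x)$ iff $s(x)\in\mathrm{dom}(h)$); $\mathrm{size}\ge 0 := \top$, $\mathrm{size}\ge 1 := \neg\mathrm{emp}$, $\mathrm{size}\ge\beta := \neg\mathrm{emp}\ast\mathrm{size}\ge\beta-1$ for $\beta\ge2$ (so $(s,h)\models \mathrm{size}\ge\beta$ iff $|\mathrm{dom}(h)|\ge\beta$); $\mathrm{size}=\beta := \mathrm{size}\ge\beta\wedge\neg\,\mathrm{size}\ge\beta+1$. For $a,b\in\mathbb{N}$, $a\dot- b=\max(0,a-b)$. Proof systems: a Hilbert-style system is a set of axiom schemata and inference rules; the derivable formulae form the least set containing all instances of the axiom schemata (metavariables $\varphi,\psi,\chi$ range over formulae, $x,y,z$ over program variables, $\beta,\beta_1,\beta_2$ over $\mathbb{N}$, $X$ over finite subsets of $\mathrm{PVAR}$) and closed under the rules. The system $\mathsf{C}(\ast,\mathrel{ -\!\!\ast})$ contains all axiom schemata of classical propositional calculus and modus ponens, together with: (1) $x=x$; (2) $\varphi\wedge x=y\Rightarrow\varphi'$, where $\varphi'$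 is obtained from $\varphi$ by replacing every occurrence of $y$ with $x$; (3) $x\hookrightarrow y\Rightarrow\mathrm{alloc}(x)$; (4) $(x\hookrightarrow y\wedge x\hookrightarrow z)\Rightarrow y=z$; (5) $(\varphi\ast\psi)\Leftrightarrow(\psi\ast\varphi)$; (6) $((\varphi\ast\psi)\ast\chi)\Leftrightarrow(\varphi\ast(\psi\ast\chi))$; (7) $\varphi\Leftrightarrow(\varphi\ast\mathrm{emp})$; (8) $(\mathrm{alloc}(x)\ast\mathrm{alloc}(x))\Leftrightarrow\bot$; (9) $(\xi\ast\top)\Rightarrow\xi$ for $\xi\in\{\neg\mathrm{emp},\ x=y,\ \neg(x=y),\ x\hookrightarrow y\}$; (10) $(\neg\mathrm{alloc}(x)\ast\neg\mathrm{alloc}(x))\Rightarrow\neg\mathrm{alloc}(x)$; (11) $((\mathrm{alloc}(x)\wedge\neg x\hookrightarrow y)\ast\top)\Rightarrow\neg x\hookrightarrow y$; (12) $\mathrm{alloc}(x)\Rightarrow((\mathrm{alloc}(x)\wedge\mathrm{size}=1)\ast\top)$; (13) $\neg\mathrm{emp}\Rightarrow(\mathrm{size}=1\ast\top)$; (14) $(\neg\,\mathrm{size}\ge\beta_1\ast\neg\,\mathrm{size}\ge\beta_2)\Rightarrow\neg\,\mathrm{size}\ge\beta_1+\beta_2\dot-1$; (15) $(\mathrm{alloc}(x)\wedge\mathrm{alloc}(y)\wedge\neg(x=y))\Rightarrow\mathrm{size}\ge2$; (16) $(\mathrm{size}=1\wedge\bigwedge_{x\in X}\neg\mathrm{alloc}(x))\mathrel{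 -\!\!\circledast}\top$; (17) $\neg\mathrm{alloc}(x)\Rightarrow((x\hookrightarrow y\wedge\mathrm{size}=1)\mathrel{ -\!\!\circledast}\top)$; (18) $\neg\mathrm{alloc}(x)\Rightarrow((\mathrm{alloc}(x)\wedge\mathrm{size}=1\wedge\bigwedge_{y\in X}\neg x\hookrightarrow y)\mathrel{ -\!\!\circledast}\top)$; and the rules: from $\varphi\Rightarrow\chi$ infer $(\varphi\ast\psi)\Rightarrow(\chi\ast\psi)$; from $(\varphi\ast\psi)\Rightarrow\chi$ infer $\varphi\Rightarrow(\psi\mathrel{ -\!\!\ast}\chi)$; from $\varphi\Rightarrow(\psi\mathrel{ -\!\!\ast}\chi)$ infer $(\varphi\ast\psi)\Rightarrow\chi$. -}

module Defs where

open import Data.Nat using (ℕ; zero; suc; _+_; _∸_; _≤_; _≟_)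
open import Data.Bool using (Bool; true; false; not; _∧_; if_then_else_)
open import Data.Maybe using (Maybe; just; nothing)
open import Data.List using (List; []; _∷_)
open import Data.Product using (Σ; _×_)
open import Data.Sum using (_⊎_)
open import Relation.Nullary using (¬_; does)
open import Relation.Binary.PropositionalEquality using (_≡_)

PVar : Set
PVar = ℕ

Loc : Set
Loc = ℕ

infixr 6 _∧'_
infixr 5 _∗_
infixr 4 _-∗_
infixr 3 _⇒_ _⇔_ _∨'_

data Form : Set where
  _≐_  : PVar → PVar → Form
  _↪_  : PVar → PVar → Form
  emp  : Form
  ¬'_  : Form → Form
  _∧'_ : Form → Form → Form
  _∗_  : Form → Form → Form
  _-∗_ : Form → Form → Form

_∨'_ : Form → Form → Form
φ ∨' ψ = ¬' (¬' φ ∧' ¬' ψ)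

_⇒_ : Form → Form → Form
φ ⇒ ψ = ¬' (φ ∧' ¬' ψ)

_⇔_ : Form → Form → Form
φ ⇔ ψ = (φ ⇒ ψ) ∧' (ψ ⇒ φ)

⊥' : Form
⊥' = ¬' (0 ≐ 0)

⊤' : Form
⊤' = ¬' ⊥'

_-⊛_ : Form → Form → Form
φ -⊛ ψ = ¬' (φ -∗ ¬' ψ)

alloc : PVar → Form
alloc x = (x ↪ x) -∗ ⊥'

size≥ : ℕ → Form
size≥ zero = ⊤'
size≥ (suc zero) = ¬' emp
size≥ (suc (suc n)) = ¬' emp ∗ size≥ (suc n)

size≡ : ℕ → Form
size≡ n = size≥ n ∧' ¬' size≥ (suc n)

⋀ : List Form → Form
⋀ [] = ⊤'
⋀ (φ ∷ φs) = φ ∧' ⋀ φs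

mapL : {A B : Set} → (A → B) → List A → List B
mapL f [] = []
mapL f (a ∷ as) = f a ∷ mapL f as

renVar : PVar → PVar → PVar → PVar
renVar y x z = if does (z ≟ y) then x else z

rename : PVar → PVar → Form → Form
rename y x (a ≐ b) = renVar y x a ≐ renVar y x b
rename y x (a ↪ b) = renVar y x a ↪ renVar y x b
rename y x emp = emp
rename y x (¬' φ) = ¬' rename y x φ
rename y x (φ ∧' ψ) = rename y x φ ∧' rename y x ψ
rename y x (φ ∗ ψ) = rename y x φ ∗ rename y x ψ
rename y x (φ -∗ ψ) = rename y x φ -∗ rename y x ψ

Store : Set
Store = PVar → Loc

-- partial functions Loc ⇀ Loc with finite domain (bounded, as Loc = ℕ)
record Heap : Set where
  field
    fun   : Loc → Maybe Loc
    bound : ℕ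
    fin   : ∀ l → bound ≤ l → fun l ≡ nothing
open Heap public

_∈dom_ : Loc → Heap → Set
l ∈dom h = ¬ (fun h l ≡ nothing)

Disjoint : Heap → Heap → Set
Disjoint h₁ h₂ = ∀ l → (fun h₁ l ≡ nothing) ⊎ (fun h₂ l ≡ nothing)

unionFun : Heap → Heap → Loc → Maybe Loc
unionFun h₁ h₂ l with fun h₁ l
... | just v  = just v
... | nothing = fun h₂ l

_≈_⊕_ : Heap → Heap → Heap → Set
h ≈ h₁ ⊕ h₂ = ∀ l → fun h l ≡ unionFun h₁ h₂ l

_,_⊨_ : Store → Heap → Form → Set
s , h ⊨ (x ≐ y) = s x ≡ s y
s , h ⊨ (x ↪ y) = fun h (s x) ≡ just (s y)
s , h ⊨ emp = ∀ l → fun h l ≡ nothing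
s , h ⊨ (¬' φ) = ¬ (s , h ⊨ φ)
s , h ⊨ (φ ∧' ψ) = (s , h ⊨ φ) × (s , h ⊨ ψ)
s , h ⊨ (φ ∗ ψ) = Σ Heap λ h₁ → Σ Heap λ h₂ →
  Disjoint h₁ h₂ × (h ≈ h₁ ⊕ h₂) × (s , h₁ ⊨ φ) × (s , h₂ ⊨ ψ)
s , h ⊨ (φ -∗ ψ) = (h₁ h' : Heap) → Disjoint h h₁ → (h' ≈ h ⊕ h₁) →
  (s , h₁ ⊨ φ) → (s , h' ⊨ ψ)

Valid : Form → Set
Valid φ = (s : Store) (h : Heap) → s , h ⊨ φ

-- Classical propositional calculus: all substitution instances of
-- propositional tautologies (over ¬, ∧).

data PForm : Set where
  pvar : ℕ → PForm
  pneg : PForm → PForm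
  pand : PForm → PForm → PForm

peval : (ℕ → Bool) → PForm → Bool
peval v (pvar n) = v n
peval v (pneg p) = not (peval v p)
peval v (pand p q) = peval v p ∧ peval v q

Tautology : PForm → Set
Tautology p = (v : ℕ → Bool) → peval v p ≡ true

instP : (ℕ → Form) → PForm → Form
instP σ (pvar n) = σ n
instP σ (pneg p) = ¬' instP σ p
instP σ (pand p q) = instP σ p ∧' instP σ q

data Axiom9 : Form → Set where
  ax9-nemp : Axiom9 (¬' emp)
  ax9-eq   : ∀ x y → Axiom9 (x ≐ y)
  ax9-neq  : ∀ x y → Axiom9 (¬' (x ≐ y))
  ax9-pt   : ∀ x y → Axiom9 (x ↪ y)

data ⊢_ : Form → Set where
  taut : ∀ p σ → Tautology p → ⊢ instP σ p
  mp   : ∀ {φ ψ} → ⊢ φ → ⊢ (φ ⇒ ψ) → ⊢ ψ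
  ax1  : ∀ x → ⊢ (x ≐ x)
  ax2  : ∀ φ x y → ⊢ ((φ ∧' (x ≐ y)) ⇒ rename y x φ)
  ax3  : ∀ x y → ⊢ ((x ↪ y) ⇒ alloc x)
  ax4  : ∀ x y z → ⊢ (((x ↪ y) ∧' (x ↪ z)) ⇒ (y ≐ z))
  ax5  : ∀ φ ψ → ⊢ ((φ ∗ ψ) ⇔ (ψ ∗ φ))
  ax6  : ∀ φ ψ χ → ⊢ (((φ ∗ ψ) ∗ χ) ⇔ (φ ∗ (ψ ∗ χ)))
  ax7  : ∀ φ → ⊢ (φ ⇔ (φ ∗ emp))
  ax8  : ∀ x → ⊢ ((alloc x ∗ alloc x) ⇔ ⊥')
  ax9  : ∀ ξ → Axiom9 ξ → ⊢ ((ξ ∗ ⊤') ⇒ ξ)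
  ax10 : ∀ x → ⊢ ((¬' alloc x ∗ ¬' alloc x) ⇒ ¬' alloc x)
  ax11 : ∀ x y → ⊢ (((alloc x ∧' ¬' (x ↪ y)) ∗ ⊤') ⇒ ¬' (x ↪ y))
  ax12 : ∀ x → ⊢ (alloc x ⇒ ((alloc x ∧' size≡ 1) ∗ ⊤'))
  ax13 : ⊢ (¬' emp ⇒ (size≡ 1 ∗ ⊤'))
  ax14 : ∀ β₁ β₂ → ⊢ ((¬' size≥ β₁ ∗ ¬' size≥ β₂) ⇒ ¬' size≥ (β₁ + β₂ ∸ 1))
  ax15 : ∀ x y → ⊢ ((alloc x ∧' alloc y ∧' ¬' (x ≐ y)) ⇒ size≥ 2)
  ax16 : ∀ (X : List PVar) →
         ⊢ ((size≡ 1 ∧' ⋀ (mapL (λ x → ¬' alloc x) X)) -⊛ ⊤')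
  ax17 : ∀ x y → ⊢ (¬' alloc x ⇒ (((x ↪ y) ∧' size≡ 1) -⊛ ⊤'))
  ax18 : ∀ x (X : List PVar) →
         ⊢ (¬' alloc x ⇒
              ((alloc x ∧' size≡ 1 ∧' ⋀ (mapL (λ y → ¬' (x ↪ y)) X)) -⊛ ⊤'))
  ∗-mono : ∀ {φ ψ χ} → ⊢ (φ ⇒ χ) → ⊢ ((φ ∗ ψ) ⇒ (χ ∗ ψ))
  curry  : ∀ {φ ψ χ} → ⊢ ((φ ∗ ψ) ⇒ χ) → ⊢ (φ ⇒ (ψ -∗ χ))
  uncurry : ∀ {φ ψ χ} → ⊢ (φ ⇒ (ψ -∗ χ)) → ⊢ ((φ ∗ ψ) ⇒ χ)

module Submission where

-- The proof is by induction on derivations; the metatheory is classical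
-- (excluded middle is a hypothesis), since the object logic has classical
-- negation and the propositional fragment is all of classical tautologies.

open import Defs
open import Data.Bool using (Bool; true; false)
open import Data.Empty using (⊥-elim)
open import Data.List using (List; []; _∷_; length; filter)
open import Data.List.Relation.Unary.All using (All; []; _∷_)
import Data.List.Relation.Unary.All as All
open import Data.List.Relation.Unary.All.Properties using (all-filter; filter⁺)
open import Data.List.Relation.Unary.AllPairs using ([]; _∷_)
open import Data.List.Relation.Unary.Unique.Propositional using (Unique)
import Data.List.Relation.Unary.Unique.Propositional.Properties as Unique
open import Data.Maybe using (Maybe; just; nothing; _<∣>_)
open import Data.Maybe.Properties using (just-injective; <∣>-assoc; <∣>-identityʳ)
open import Data.Nat using (ℕ; zero; suc; _+_; _∸_; _≤_; _<_; _≟_; _⊔_; z≤n; s≤s)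
open import Data.Nat.Properties
  using (≤-refl; ≤-trans; <-irrefl; <⇒≢; ≤⇒≯; ≰⇒>; m≤m+n; m≤n+m; m≤m⊔n; m≤n⊔m; +-suc; +-mono-≤-<)
open import Data.Product using (Σ; ∃; _×_; _,_; proj₁; proj₂)
open import Data.Sum using (_⊎_; inj₁; inj₂)
open import Relation.Nullary using (¬_; Dec; yes; no; does; proof)
open import Relation.Nullary.Decidable using (fromSum; decidable-stable; dec-true; dec-false)
open import Relation.Nullary.Reflects using (Reflects; invert; ¬-reflects; _×-reflects_)
open import Relation.Unary.Properties using (∁?)
open import Relation.Binary.PropositionalEquality

unionFun-<∣> : ∀ h₁ h₂ l → unionFun h₁ h₂ l ≡ fun h₁ l <∣> fun h₂ l
unionFun-<∣> h₁ h₂ l with fun h₁ l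
... | just _  = refl
... | nothing = refl

Apart : Maybe Loc → Maybe Loc → Set
Apart a b = (a ≡ nothing) ⊎ (b ≡ nothing)

Apart-sym : ∀ {a b} → Apart a b → Apart b a
Apart-sym (inj₁ p) = inj₂ p
Apart-sym (inj₂ p) = inj₁ p

<∣>-comm : ∀ a b → Apart a b → a <∣> b ≡ b <∣> a
<∣>-comm nothing  b        _         = sym (<∣>-identityʳ b)
<∣>-comm (just _) nothing  _         = refl
<∣>-comm (just _) (just _) (inj₁ ())
<∣>-comm (just _) (just _) (inj₂ ())

Apart-assoc : ∀ a b c → Apart a b → Apart (a <∣> b) c → Apart a (b <∣> c) × Apart b c
Apart-assoc nothing  b        c _         d = inj₁ refl , d
Apart-assoc (just _) nothing  c _         d = d , inj₁ refl
Apart-assoc (just _) (just _) c (inj₁ ()) _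
Apart-assoc (just _) (just _) c (inj₂ ()) _

∅ₕ : Heap
∅ₕ = record { fun = λ _ → nothing ; bound = 0 ; fin = λ _ _ → refl }

-- The union of two heaps (it represents h₁ + h₂ when they are disjoint).
_+ₕ_ : Heap → Heap → Heap
h₁ +ₕ h₂ = record { fun = unionFun h₁ h₂ ; bound = bound h₁ + bound h₂ ; fin = finite }
  where
  finite : ∀ l → bound h₁ + bound h₂ ≤ l → unionFun h₁ h₂ l ≡ nothing
  finite l le rewrite unionFun-<∣> h₁ h₂ l
                    | fin h₁ l (≤-trans (m≤m+n _ _) le)
                    | fin h₂ l (≤-trans (m≤n+m _ _) le) = refl

cellFun : Loc → Loc → Loc → Maybe Loc
cellFun l v m with m ≟ l
... | yes _ = just v
... | no _  = nothing

↦-at : ∀ l v → cellFun l v l ≡ just v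
↦-at l v with l ≟ l
... | yes _ = refl
... | no l≢l = ⊥-elim (l≢l refl)

↦-off : ∀ l v m → ¬ m ≡ l → cellFun l v m ≡ nothing
↦-off l v m m≢l with m ≟ l
... | yes m≡l = ⊥-elim (m≢l m≡l)
... | no _    = refl

↦-dom : ∀ l v m → ¬ cellFun l v m ≡ nothing → m ≡ l
↦-dom l v m m∈ with m ≟ l
... | yes m≡l = m≡l
... | no _    = ⊥-elim (m∈ refl)

[_↦_] : Loc → Loc → Heap
[ l ↦ v ] = record { fun = cellFun l v ; bound = suc l
                   ; fin = λ m le → ↦-off l v m (λ m≡l → <-irrefl (sym m≡l) le) }

removeFun : Heap → Loc → Loc → Maybe Loc
removeFun h l m with m ≟ l
... | yes _ = nothing
... | no _  = fun h m

∖-off : ∀ h l m → ¬ m ≡ l → removeFun h l m ≡ fun h m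
∖-off h l m m≢l with m ≟ l
... | yes m≡l = ⊥-elim (m≢l m≡l)
... | no _    = refl

_∖_ : Heap → Loc → Heap
h ∖ l = record { fun = removeFun h l ; bound = bound h ; fin = finite }
  where
  finite : ∀ m → bound h ≤ m → removeFun h l m ≡ nothing
  finite m le with m ≟ l
  ... | yes _ = refl
  ... | no _  = fin h m le

split-cell : ∀ h l v → fun h l ≡ just v → Disjoint [ l ↦ v ] (h ∖ l) × (h ≈ [ l ↦ v ] ⊕ (h ∖ l))
split-cell h l v hl = apart , union
  where
  apart : Disjoint [ l ↦ v ] (h ∖ l)
  apart m with m ≟ l
  ... | yes _ = inj₂ refl
  ... | no _  = inj₁ refl
  union : h ≈ [ l ↦ v ] ⊕ (h ∖ l)
  union m rewrite unionFun-<∣> [ l ↦ v ] (h ∖ l) m with m ≟ l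
  ... | yes refl = hl
  ... | no _     = refl

fresh-cell : ∀ h l v → fun h l ≡ nothing → Disjoint h [ l ↦ v ]
fresh-cell h l v hl m with m ≟ l
... | yes refl = inj₁ hl
... | no _     = inj₂ refl

∈dom⇒points : ∀ h {l} → l ∈dom h → ∃ λ v → fun h l ≡ just v
∈dom⇒points h {l} l∈ with fun h l
... | just v  = v , refl
... | nothing = ⊥-elim (l∈ refl)

points⇒∈dom : ∀ h {l v} → fun h l ≡ just v → l ∈dom h
points⇒∈dom h hl hl≡nothing with trans (sym hl) hl≡nothing
... | ()

∈dom? : ∀ h l → Dec (l ∈dom h)
∈dom? h l with fun h l
... | just _  = yes λ ()
... | nothing = no λ l∈ → l∈ refl

∉dom⇒free : ∀ h {l} → ¬ l ∈dom h → fun h l ≡ nothing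
∉dom⇒free h {l} l∉ with fun h l
... | just _  = ⊥-elim (l∉ λ ())
... | nothing = refl

-- Facts about a heap h split as h₁ + h₂, read off location by location.
-- Heaps are explicit arguments throughout: they cannot be inferred from
-- the unfolded types of splits and satisfaction.
module _ (h h₁ h₂ : Heap) (h≈ : h ≈ h₁ ⊕ h₂) where

  ⊕-at : ∀ l → fun h l ≡ fun h₁ l <∣> fun h₂ l
  ⊕-at l = trans (h≈ l) (unionFun-<∣> h₁ h₂ l)

  ⊕-pointsˡ : ∀ {l v} → fun h₁ l ≡ just v → fun h l ≡ just v
  ⊕-pointsˡ {l} h₁l = trans (⊕-at l) (cong (_<∣> fun h₂ l) h₁l)

  ⊕-freeˡ : ∀ {l} → fun h₁ l ≡ nothing → fun h l ≡ fun h₂ l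
  ⊕-freeˡ {l} h₁l = trans (⊕-at l) (cong (_<∣> fun h₂ l) h₁l)

  ⊕-domˡ : ∀ {l} → l ∈dom h₁ → l ∈dom h
  ⊕-domˡ l∈ = points⇒∈dom h (⊕-pointsˡ (proj₂ (∈dom⇒points h₁ l∈)))

  ⊕-domʳ : ∀ {l} → l ∈dom h₂ → l ∈dom h
  ⊕-domʳ {l} l∈ with fun h₁ l in h₁l
  ... | just _  = points⇒∈dom h (⊕-pointsˡ h₁l)
  ... | nothing = λ hl → l∈ (trans (sym (⊕-freeˡ h₁l)) hl)

  ⊕-domʳ⁻ : ∀ {l} → l ∈dom h → ¬ l ∈dom h₁ → l ∈dom h₂
  ⊕-domʳ⁻ l∈ l∉ = λ h₂l → l∈ (trans (⊕-freeˡ (∉dom⇒free h₁ l∉)) h₂l)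

_≗ₕ_ : Heap → Heap → Set
h ≗ₕ h' = ∀ l → fun h l ≡ fun h' l

⊨-cong : ∀ φ s {h h'} → h ≗ₕ h' → s , h ⊨ φ → s , h' ⊨ φ
⊨-cong (x ≐ y)  s h≗ p = p
⊨-cong (x ↪ y)  s h≗ p = trans (sym (h≗ (s x))) p
⊨-cong emp      s h≗ p = λ l → trans (sym (h≗ l)) (p l)
⊨-cong (¬' φ)   s h≗ p = λ q → p (⊨-cong φ s (λ l → sym (h≗ l)) q)
⊨-cong (φ ∧' ψ) s h≗ (p , q) = ⊨-cong φ s h≗ p , ⊨-cong ψ s h≗ q
⊨-cong (φ ∗ ψ)  s h≗ (h₁ , h₂ , d , h≈ , p , q) =
  h₁ , h₂ , d , (λ l → trans (sym (h≗ l)) (h≈ l)) , p , q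
⊨-cong (φ -∗ ψ) s {h} {h'} h≗ f h₁ h'' d h''≈ p = f h₁ h'' d' h''≈' p
  where
  d' : Disjoint h h₁
  d' l with d l
  ... | inj₁ h'l = inj₁ (trans (h≗ l) h'l)
  ... | inj₂ h₁l = inj₂ h₁l
  h''≈' : h'' ≈ h ⊕ h₁
  h''≈' l = begin
    fun h'' l                ≡⟨ h''≈ l ⟩
    unionFun h' h₁ l         ≡⟨ unionFun-<∣> h' h₁ l ⟩
    fun h' l <∣> fun h₁ l    ≡⟨ cong (_<∣> fun h₁ l) (sym (h≗ l)) ⟩
    fun h l <∣> fun h₁ l     ≡⟨ sym (unionFun-<∣> h h₁ l) ⟩
    unionFun h h₁ l          ∎
    where open ≡-Reasoning

_⟷_ : Set → Set → Set
A ⟷ B = (A → B) × (B → A)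

module _ (y x : PVar) (s : Store) (same : ∀ z → s (renVar y x z) ≡ s z) where

  rename-⟷ : ∀ φ h → (s , h ⊨ φ) ⟷ (s , h ⊨ rename y x φ)
  rename-⟷ (a ≐ b)  h rewrite same a | same b = (λ p → p) , (λ p → p)
  rename-⟷ (a ↪ b)  h rewrite same a | same b = (λ p → p) , (λ p → p)
  rename-⟷ emp      h = (λ p → p) , (λ p → p)
  rename-⟷ (¬' φ)   h = (λ p q → p (proj₂ (rename-⟷ φ h) q)) , (λ p q → p (proj₁ (rename-⟷ φ h) q))
  rename-⟷ (φ ∧' ψ) h =
    (λ (p , q) → proj₁ (rename-⟷ φ h) p , proj₁ (rename-⟷ ψ h) q) ,
    (λ (p , q) → proj₂ (rename-⟷ φ h) p , proj₂ (rename-⟷ ψ h) q)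
  rename-⟷ (φ ∗ ψ)  h =
    (λ (h₁ , h₂ , d , h≈ , p , q) →
       h₁ , h₂ , d , h≈ , proj₁ (rename-⟷ φ h₁) p , proj₁ (rename-⟷ ψ h₂) q) ,
    (λ (h₁ , h₂ , d , h≈ , p , q) →
       h₁ , h₂ , d , h≈ , proj₂ (rename-⟷ φ h₁) p , proj₂ (rename-⟷ ψ h₂) q)
  rename-⟷ (φ -∗ ψ) h =
    (λ f h₁ h' d h'≈ p → proj₁ (rename-⟷ ψ h') (f h₁ h' d h'≈ (proj₂ (rename-⟷ φ h₁) p))) ,
    (λ f h₁ h' d h'≈ p → proj₂ (rename-⟷ ψ h') (f h₁ h' d h'≈ (proj₁ (rename-⟷ φ h₁) p)))

renVar-same : ∀ y x (s : Store) → s x ≡ s y → ∀ z → s (renVar y x z) ≡ s z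
renVar-same y x s sx≡sy z with z ≟ y
... | yes refl rewrite dec-true (z ≟ z) refl = sx≡sy
... | no z≢y   rewrite dec-false (z ≟ y) z≢y = refl

LEM : Set₁
LEM = (P : Set) → P ⊎ ¬ P

decide : LEM → (P : Set) → Dec P
decide lem P = fromSum (lem P)

classical : LEM → {P : Set} → ¬ ¬ P → P
classical lem {P} = decidable-stable (decide lem P)

⇒-valid : ∀ φ ψ → (∀ s h → s , h ⊨ φ → s , h ⊨ ψ) → Valid (φ ⇒ ψ)
⇒-valid φ ψ entails s h (p , ¬q) = ¬q (entails s h p)

⇒-elim : LEM → ∀ φ ψ → Valid (φ ⇒ ψ) → ∀ s h → s , h ⊨ φ → s , h ⊨ ψ
⇒-elim lem φ ψ valid s h p = classical lem λ ¬q → valid s h (p , ¬q)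

⇔-valid : ∀ φ ψ → (∀ s h → s , h ⊨ φ → s , h ⊨ ψ) → (∀ s h → s , h ⊨ ψ → s , h ⊨ φ) →
          Valid (φ ⇔ ψ)
⇔-valid φ ψ to from s h = ⇒-valid φ ψ to s h , ⇒-valid ψ φ from s h

⊤-holds : ∀ s h → s , h ⊨ ⊤'
⊤-holds s h ¬refl = ¬refl refl

truthValuation : LEM → (ℕ → Form) → Store → Heap → ℕ → Bool
truthValuation lem σ s h n = does (decide lem (s , h ⊨ σ n))

instP-reflects : ∀ lem σ s h p → Reflects (s , h ⊨ instP σ p) (peval (truthValuation lem σ s h) p)
instP-reflects lem σ s h (pvar n)   = proof (decide lem (s , h ⊨ σ n))
instP-reflects lem σ s h (pneg p)   = ¬-reflects (instP-reflects lem σ s h p)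
instP-reflects lem σ s h (pand p q) = instP-reflects lem σ s h p ×-reflects instP-reflects lem σ s h q

tautology-valid : LEM → ∀ p σ → Tautology p → Valid (instP σ p)
tautology-valid lem p σ tautological s h =
  invert (subst (Reflects _) (tautological (truthValuation lem σ s h)) (instP-reflects lem σ s h p))

-- alloc x holds iff s x is allocated: only then can no cell for x be added.
alloc⇒∈dom : ∀ s h x → s , h ⊨ alloc x → s x ∈dom h
alloc⇒∈dom s h x addable sx-free =
  addable [ s x ↦ s x ] (h +ₕ [ s x ↦ s x ]) (fresh-cell h (s x) (s x) sx-free)
          (λ _ → refl) (↦-at (s x) (s x)) refl

∈dom⇒alloc : ∀ s h x → s x ∈dom h → s , h ⊨ alloc x
∈dom⇒alloc s h x sx∈ h₁ h' d h'≈ x↪x with d (s x)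
... | inj₁ sx-free = ⊥-elim (sx∈ sx-free)
... | inj₂ sx-free = ⊥-elim (points⇒∈dom h₁ x↪x sx-free)

¬alloc⇒free : ∀ s h x → ¬ (s , h ⊨ alloc x) → fun h (s x) ≡ nothing
¬alloc⇒free s h x ¬alloc = ∉dom⇒free h (λ sx∈ → ¬alloc (∈dom⇒alloc s h x sx∈))

⋀-intro : ∀ s h (f : PVar → Form) X → All (λ x → s , h ⊨ f x) X → s , h ⊨ ⋀ (mapL f X)
⋀-intro s h f []      []       = ⊤-holds s h
⋀-intro s h f (x ∷ X) (p ∷ ps) = p , ⋀-intro s h f X ps

-⊛⊤-intro : ∀ s h h₁ φ → Disjoint h h₁ → s , h₁ ⊨ φ → s , h ⊨ (φ -⊛ ⊤')
-⊛⊤-intro s h h₁ φ d p ¬extend = ¬extend h₁ (h +ₕ h₁) d (λ _ → refl) p (⊤-holds s (h +ₕ h₁))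

∗-comm : ∀ φ ψ s h → s , h ⊨ (φ ∗ ψ) → s , h ⊨ (ψ ∗ φ)
∗-comm φ ψ s h (h₁ , h₂ , d , h≈ , p , q) = h₂ , h₁ , (λ l → Apart-sym (d l)) , h≈' , q , p
  where
  h≈' : h ≈ h₂ ⊕ h₁
  h≈' l = begin
    fun h l                ≡⟨ ⊕-at h h₁ h₂ h≈ l ⟩
    fun h₁ l <∣> fun h₂ l  ≡⟨ <∣>-comm (fun h₁ l) (fun h₂ l) (d l) ⟩
    fun h₂ l <∣> fun h₁ l  ≡⟨ sym (unionFun-<∣> h₂ h₁ l) ⟩
    unionFun h₂ h₁ l       ∎
    where open ≡-Reasoning

∗-assocˡ : ∀ φ ψ χ s h → s , h ⊨ ((φ ∗ ψ) ∗ χ) → s , h ⊨ (φ ∗ (ψ ∗ χ))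
∗-assocˡ φ ψ χ s h (h₁₂ , h₃ , d , h≈ , (h₁ , h₂ , d₁₂ , h₁₂≈ , p , q) , r) =
  h₁ , h₂ +ₕ h₃ , d₁ , h≈' , p , (h₂ , h₃ , d₂₃ , (λ _ → refl) , q , r)
  where
  apart : ∀ l → Apart (fun h₁ l) (fun h₂ l <∣> fun h₃ l) × Apart (fun h₂ l) (fun h₃ l)
  apart l = Apart-assoc (fun h₁ l) (fun h₂ l) (fun h₃ l) (d₁₂ l)
              (subst (λ a → Apart a (fun h₃ l)) (⊕-at h₁₂ h₁ h₂ h₁₂≈ l) (d l))
  d₂₃ : Disjoint h₂ h₃
  d₂₃ l = proj₂ (apart l)
  d₁ : Disjoint h₁ (h₂ +ₕ h₃)
  d₁ l = subst (Apart (fun h₁ l)) (sym (unionFun-<∣> h₂ h₃ l)) (proj₁ (apart l))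
  h≈' : h ≈ h₁ ⊕ (h₂ +ₕ h₃)
  h≈' l = begin
    fun h l                                ≡⟨ ⊕-at h h₁₂ h₃ h≈ l ⟩
    fun h₁₂ l <∣> fun h₃ l                 ≡⟨ cong (_<∣> fun h₃ l) (⊕-at h₁₂ h₁ h₂ h₁₂≈ l) ⟩
    (fun h₁ l <∣> fun h₂ l) <∣> fun h₃ l   ≡⟨ <∣>-assoc (fun h₁ l) (fun h₂ l) (fun h₃ l) ⟩
    fun h₁ l <∣> (fun h₂ l <∣> fun h₃ l)   ≡⟨ cong (fun h₁ l <∣>_) (sym (unionFun-<∣> h₂ h₃ l)) ⟩
    fun h₁ l <∣> fun (h₂ +ₕ h₃) l          ≡⟨ sym (unionFun-<∣> h₁ (h₂ +ₕ h₃) l) ⟩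
    unionFun h₁ (h₂ +ₕ h₃) l               ∎
    where open ≡-Reasoning

-- The converse re-association follows by commuting around ∗-assocˡ.
∗-assocʳ : ∀ φ ψ χ s h → s , h ⊨ (φ ∗ (ψ ∗ χ)) → s , h ⊨ ((φ ∗ ψ) ∗ χ)
∗-assocʳ φ ψ χ s h p =
  ∗-comm χ (φ ∗ ψ) s h (∗-assocˡ χ φ ψ s h (∗-comm ψ (χ ∗ φ) s h
    (∗-assocˡ ψ χ φ s h (∗-comm φ (ψ ∗ χ) s h p))))

∗-emp-intro : ∀ φ s h → s , h ⊨ φ → s , h ⊨ (φ ∗ emp)
∗-emp-intro φ s h p = h , ∅ₕ , (λ _ → inj₂ refl) , h≈ , p , (λ _ → refl)
  where
  h≈ : h ≈ h ⊕ ∅ₕ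
  h≈ l = sym (trans (unionFun-<∣> h ∅ₕ l) (<∣>-identityʳ (fun h l)))

∗-emp-elim : ∀ φ s h → s , h ⊨ (φ ∗ emp) → s , h ⊨ φ
∗-emp-elim φ s h (h₁ , h₂ , d , h≈ , p , h₂-empty) = ⊨-cong φ s h₁≗h p
  where
  h₁≗h : h₁ ≗ₕ h
  h₁≗h l = sym (begin
    fun h l                ≡⟨ ⊕-at h h₁ h₂ h≈ l ⟩
    fun h₁ l <∣> fun h₂ l  ≡⟨ cong (fun h₁ l <∣>_) (h₂-empty l) ⟩
    fun h₁ l <∣> nothing   ≡⟨ <∣>-identityʳ (fun h₁ l) ⟩
    fun h₁ l               ∎)
    where open ≡-Reasoning

cell-∗ : ∀ φ ψ s h {l v} → fun h l ≡ just v →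
         s , [ l ↦ v ] ⊨ φ → s , h ∖ l ⊨ ψ → s , h ⊨ (φ ∗ ψ)
cell-∗ φ ψ s h {l} {v} hl p q =
  [ l ↦ v ] , h ∖ l , proj₁ (split-cell h l v hl) , proj₂ (split-cell h l v hl) , p , q

-- Sizes

AtLeast : ℕ → Heap → Set
AtLeast n h = Σ (List Loc) λ L → Unique L × All (_∈dom h) L × n ≤ length L

nonempty⇒∈dom : LEM → ∀ h → ¬ (∀ l → fun h l ≡ nothing) → ∃ λ l → l ∈dom h
nonempty⇒∈dom lem h nonempty =
  classical lem λ none → nonempty λ l → ∉dom⇒free h (λ l∈ → none (l , l∈))

↦-nonempty : ∀ s l v → s , [ l ↦ v ] ⊨ (¬' emp)
↦-nonempty s l v empty = points⇒∈dom [ l ↦ v ] (↦-at l v) (empty l)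

∖-dom : ∀ h l m → ¬ l ≡ m → m ∈dom h → m ∈dom (h ∖ l)
∖-dom h l m l≢m m∈ free = m∈ (trans (sym (∖-off h l m (λ m≡l → l≢m (sym m≡l)))) free)

disjoint-≢ : ∀ h₁ h₂ → Disjoint h₁ h₂ → ∀ {l m} → l ∈dom h₁ → m ∈dom h₂ → ¬ l ≡ m
disjoint-≢ h₁ h₂ d {l} l∈ m∈ refl with d l
... | inj₁ free = l∈ free
... | inj₂ free = m∈ free

-- size≥ n means exactly "at least n cells".  Distinct allocated locations
-- give size≥ n by splitting off one cell per location...
AtLeast⇒size≥ : ∀ n s h → AtLeast n h → s , h ⊨ size≥ n
AtLeast⇒size≥ zero          s h _                              = ⊤-holds s h
AtLeast⇒size≥ (suc zero)    s h (l ∷ _ , _ , l∈ ∷ _ , _) empty = l∈ (empty l)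
AtLeast⇒size≥ (suc (suc n)) s h ([] , _ , _ , ())
AtLeast⇒size≥ (suc (suc n)) s h (l ∷ L , l∉L ∷ unique , l∈ ∷ L∈ , s≤s n≤) =
  cell-∗ (¬' emp) (size≥ (suc n)) s h (proj₂ (∈dom⇒points h l∈)) (↦-nonempty s l _)
    (AtLeast⇒size≥ (suc n) s (h ∖ l) (L , unique , L∈' , n≤))
  where
  L∈' : All (_∈dom (h ∖ l)) L
  L∈' = All.zipWith (λ (l≢m , m∈) → ∖-dom h l _ l≢m m∈) (l∉L , L∈)

-- ... and conversely (classically) each nonempty part of a split
-- contributes an allocated location distinct from those of the rest.
size≥⇒AtLeast : LEM → ∀ n s h → s , h ⊨ size≥ n → AtLeast n h
size≥⇒AtLeast lem zero s h _ = [] , [] , [] , z≤n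
size≥⇒AtLeast lem (suc zero) s h nonempty with nonempty⇒∈dom lem h nonempty
... | l , l∈ = l ∷ [] , [] ∷ [] , l∈ ∷ [] , s≤s z≤n
size≥⇒AtLeast lem (suc (suc n)) s h (h₁ , h₂ , d , h≈ , nonempty , rest)
  with nonempty⇒∈dom lem h₁ nonempty | size≥⇒AtLeast lem (suc n) s h₂ rest
... | l , l∈ | L , unique , L∈ , n≤ =
  l ∷ L , All.map (disjoint-≢ h₁ h₂ d l∈) L∈ ∷ unique ,
  ⊕-domˡ h h₁ h₂ h≈ l∈ ∷ All.map (⊕-domʳ h h₁ h₂ h≈) L∈ , s≤s n≤

fewer-than : ∀ β s h {m} → ¬ (s , h ⊨ size≥ β) → AtLeast m h → m < β
fewer-than β s h small (L , unique , L∈ , m≤) =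
  ≰⇒> λ β≤m → small (AtLeast⇒size≥ β s h (L , unique , L∈ , ≤-trans β≤m m≤))

↦-size≡1 : LEM → ∀ s l v → s , [ l ↦ v ] ⊨ size≡ 1
↦-size≡1 lem s l v = ↦-nonempty s l v , λ two → no-two (size≥⇒AtLeast lem 2 s [ l ↦ v ] two)
  where
  no-two : ¬ AtLeast 2 [ l ↦ v ]
  no-two ([] , _ , _ , ())
  no-two (_ ∷ [] , _ , _ , s≤s ())
  no-two (a ∷ b ∷ _ , (a≢b ∷ _) ∷ _ , a∈ ∷ b∈ ∷ _ , _) =
    a≢b (trans (↦-dom l v a a∈) (sym (↦-dom l v b b∈)))

length-filter-∁ : ∀ {A : Set} {P : A → Set} (P? : ∀ a → Dec (P a)) xs →
                  length (filter P? xs) + length (filter (∁? P?) xs) ≡ length xs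
length-filter-∁ P? []       = refl
length-filter-∁ P? (x ∷ xs) with does (P? x)
... | true  = cong suc (length-filter-∁ P? xs)
... | false = trans (+-suc _ _) (cong suc (length-filter-∁ P? xs))

-- The cells of h = h₁ + h₂ are distributed between h₁ and h₂: sort the
-- allocated locations of h by whether they are allocated in h₁.
AtLeast-⊕ : ∀ h h₁ h₂ → h ≈ h₁ ⊕ h₂ → ∀ {n} → AtLeast n h →
            Σ ℕ λ n₁ → Σ ℕ λ n₂ → AtLeast n₁ h₁ × AtLeast n₂ h₂ × n ≤ n₁ + n₂
AtLeast-⊕ h h₁ h₂ h≈ {n} (L , unique , L∈ , n≤) =
  length L₁ , length L₂ ,
  (L₁ , Unique.filter⁺ in₁? unique , all-filter in₁? L , ≤-refl) ,
  (L₂ , Unique.filter⁺ (∁? in₁?) unique , L₂∈ , ≤-refl) ,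
  subst (n ≤_) (sym (length-filter-∁ in₁? L)) n≤
  where
  in₁? : ∀ l → Dec (l ∈dom h₁)
  in₁? = ∈dom? h₁
  L₁ L₂ : List Loc
  L₁ = filter in₁? L
  L₂ = filter (∁? in₁?) L
  L₂∈ : All (_∈dom h₂) L₂
  L₂∈ = All.zipWith (λ (m∈ , m∉) → ⊕-domʳ⁻ h h₁ h₂ h≈ m∈ m∉)
                    (filter⁺ (∁? in₁?) L∈ , all-filter (∁? in₁?) L)

sum-below : ∀ {n₁ n₂ β₁ β₂} → n₁ < β₁ → n₂ < β₂ → n₁ + n₂ < β₁ + β₂ ∸ 1
sum-below {β₁ = suc _} (s≤s n₁≤) n₂< = +-mono-≤-< n₁≤ n₂<

↦-alloc : ∀ s x v → s , [ s x ↦ v ] ⊨ alloc x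
↦-alloc s x v = ∈dom⇒alloc s [ s x ↦ v ] x (points⇒∈dom [ s x ↦ v ] (↦-at (s x) v))

↦-¬alloc : ∀ s x l v → ¬ s x ≡ l → ¬ (s , [ l ↦ v ] ⊨ alloc x)
↦-¬alloc s x l v sx≢l allocated = alloc⇒∈dom s [ l ↦ v ] x allocated (↦-off l v (s x) sx≢l)

↦-¬points : ∀ s x y v → ¬ s y ≡ v → ¬ (s , [ s x ↦ v ] ⊨ (x ↪ y))
↦-¬points s x y v sy≢v x↪y = sy≢v (just-injective (trans (sym x↪y) (↦-at (s x) v)))

maxVal : Store → List PVar → ℕ
maxVal s []      = 0
maxVal s (x ∷ X) = s x ⊔ maxVal s X

maxVal-bound : ∀ s X → All (λ x → s x ≤ maxVal s X) X
maxVal-bound s []      = []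
maxVal-bound s (x ∷ X) =
  m≤m⊔n (s x) (maxVal s X) ∷ All.map (λ le → ≤-trans le (m≤n⊔m (s x) (maxVal s X))) (maxVal-bound s X)

above-maxVal : ∀ s X {l} → maxVal s X < l → All (λ x → ¬ s x ≡ l) X
above-maxVal s X max<l = All.map (λ le → <⇒≢ (≤-trans (s≤s le) max<l)) (maxVal-bound s X)

-- Validity of the axioms

rename-valid : ∀ φ x y → Valid ((φ ∧' (x ≐ y)) ⇒ rename y x φ)
rename-valid φ x y = ⇒-valid (φ ∧' (x ≐ y)) (rename y x φ)
  λ s h (p , sx≡sy) → proj₁ (rename-⟷ y x s (renVar-same y x s sx≡sy) φ h) p

points⇒alloc-valid : ∀ x y → Valid ((x ↪ y) ⇒ alloc x)
points⇒alloc-valid x y = ⇒-valid (x ↪ y) (alloc x)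
  λ s h x↪y → ∈dom⇒alloc s h x (points⇒∈dom h x↪y)

points-functional-valid : ∀ x y z → Valid (((x ↪ y) ∧' (x ↪ z)) ⇒ (y ≐ z))
points-functional-valid x y z = ⇒-valid ((x ↪ y) ∧' (x ↪ z)) (y ≐ z)
  λ s h (x↪y , x↪z) → just-injective (trans (sym x↪y) x↪z)

-- (8) A location cannot be allocated in two disjoint heaps.
alloc-∗-alloc-valid : ∀ x → Valid ((alloc x ∗ alloc x) ⇔ ⊥')
alloc-∗-alloc-valid x = ⇔-valid (alloc x ∗ alloc x) ⊥'
  (λ s h (h₁ , h₂ , d , _ , a₁ , a₂) _ →
     disjoint-≢ h₁ h₂ d (alloc⇒∈dom s h₁ x a₁) (alloc⇒∈dom s h₂ x a₂) refl)
  (λ s h absurd → ⊥-elim (absurd refl))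

atom-⊕ : ∀ ξ → Axiom9 ξ → ∀ s h h₁ h₂ → h ≈ h₁ ⊕ h₂ → s , h₁ ⊨ ξ → s , h ⊨ ξ
atom-⊕ _ ax9-nemp      s h h₁ h₂ h≈ nonempty empty =
  nonempty λ l → ∉dom⇒free h₁ λ l∈ → ⊕-domˡ h h₁ h₂ h≈ l∈ (empty l)
atom-⊕ _ (ax9-eq x y)  s h h₁ h₂ h≈ x≐y = x≐y
atom-⊕ _ (ax9-neq x y) s h h₁ h₂ h≈ x≠y = x≠y
atom-⊕ _ (ax9-pt x y)  s h h₁ h₂ h≈ x↪y = ⊕-pointsˡ h h₁ h₂ h≈ x↪y

atom-∗⊤-valid : ∀ ξ → Axiom9 ξ → Valid ((ξ ∗ ⊤') ⇒ ξ)
atom-∗⊤-valid ξ atom = ⇒-valid (ξ ∗ ⊤') ξ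
  λ s h (h₁ , h₂ , _ , h≈ , p , _) → atom-⊕ ξ atom s h h₁ h₂ h≈ p

¬alloc-∗-valid : ∀ x → Valid ((¬' alloc x ∗ ¬' alloc x) ⇒ ¬' alloc x)
¬alloc-∗-valid x = ⇒-valid (¬' alloc x ∗ ¬' alloc x) (¬' alloc x)
  λ s h (h₁ , h₂ , _ , h≈ , ¬a₁ , ¬a₂) allocated →
    alloc⇒∈dom s h x allocated
      (trans (⊕-freeˡ h h₁ h₂ h≈ (¬alloc⇒free s h₁ x ¬a₁)) (¬alloc⇒free s h₂ x ¬a₂))

-- (11) The content of an allocated cell is not changed by extending the heap.
alloc-¬points-∗⊤-valid : ∀ x y → Valid (((alloc x ∧' ¬' (x ↪ y)) ∗ ⊤') ⇒ ¬' (x ↪ y))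
alloc-¬points-∗⊤-valid x y = ⇒-valid ((alloc x ∧' ¬' (x ↪ y)) ∗ ⊤') (¬' (x ↪ y))
  λ s h (h₁ , h₂ , _ , h≈ , (a , ¬x↪y) , _) x↪y →
    let (v , h₁sx) = ∈dom⇒points h₁ (alloc⇒∈dom s h₁ x a)
    in ¬x↪y (trans h₁sx (trans (sym (⊕-pointsˡ h h₁ h₂ h≈ h₁sx)) x↪y))

alloc-cell-valid : LEM → ∀ x → Valid (alloc x ⇒ ((alloc x ∧' size≡ 1) ∗ ⊤'))
alloc-cell-valid lem x = ⇒-valid (alloc x) ((alloc x ∧' size≡ 1) ∗ ⊤')
  λ s h allocated →
    let (v , hsx) = ∈dom⇒points h (alloc⇒∈dom s h x allocated)
    in cell-∗ (alloc x ∧' size≡ 1) ⊤' s h hsx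
              (↦-alloc s x v , ↦-size≡1 lem s (s x) v) (⊤-holds s (h ∖ s x))

nonempty-cell-valid : LEM → Valid (¬' emp ⇒ (size≡ 1 ∗ ⊤'))
nonempty-cell-valid lem = ⇒-valid (¬' emp) (size≡ 1 ∗ ⊤')
  λ s h nonempty →
    let (l , l∈) = nonempty⇒∈dom lem h nonempty
        (v , hl) = ∈dom⇒points h l∈
    in cell-∗ (size≡ 1) ⊤' s h hl (↦-size≡1 lem s l v) (⊤-holds s (h ∖ l))

-- (14) Sizes of disjoint heaps add up.
size-subadditive-valid : LEM → ∀ β₁ β₂ →
  Valid ((¬' size≥ β₁ ∗ ¬' size≥ β₂) ⇒ ¬' size≥ (β₁ + β₂ ∸ 1))
size-subadditive-valid lem β₁ β₂ =
  ⇒-valid (¬' size≥ β₁ ∗ ¬' size≥ β₂) (¬' size≥ (β₁ + β₂ ∸ 1))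
  λ s h (h₁ , h₂ , _ , h≈ , small₁ , small₂) big →
    let (n₁ , n₂ , cells₁ , cells₂ , n≤) = AtLeast-⊕ h h₁ h₂ h≈ (size≥⇒AtLeast lem _ s h big)
    in ≤⇒≯ n≤ (sum-below (fewer-than β₁ s h₁ small₁ cells₁)
                         (fewer-than β₂ s h₂ small₂ cells₂))

two-alloc-valid : ∀ x y → Valid ((alloc x ∧' alloc y ∧' ¬' (x ≐ y)) ⇒ size≥ 2)
two-alloc-valid x y = ⇒-valid (alloc x ∧' alloc y ∧' ¬' (x ≐ y)) (size≥ 2)
  λ s h (ax , ay , x≠y) →
    AtLeast⇒size≥ 2 s h (s x ∷ s y ∷ [] , (x≠y ∷ []) ∷ [] ∷ [] ,
                         alloc⇒∈dom s h x ax ∷ alloc⇒∈dom s h y ay ∷ [] , ≤-refl)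

-- (16) A cell beyond the heap's bound and the values of X can be added.
fresh-cell-valid : LEM → ∀ X → Valid ((size≡ 1 ∧' ⋀ (mapL (λ x → ¬' alloc x) X)) -⊛ ⊤')
fresh-cell-valid lem X s h =
  -⊛⊤-intro s h [ l ↦ 0 ] (size≡ 1 ∧' ⋀ (mapL (λ x → ¬' alloc x) X))
    (fresh-cell h l 0 (fin h l (m≤m+n (bound h) (suc (maxVal s X)))))
    (↦-size≡1 lem s l 0 ,
     ⋀-intro s [ l ↦ 0 ] (λ x → ¬' alloc x) X
       (All.map (λ sx≢l → ↦-¬alloc s _ l 0 sx≢l)
                (above-maxVal s X (m≤n+m (suc (maxVal s X)) (bound h)))))
  where
  l : Loc
  l = bound h + suc (maxVal s X)

-- (17) A cell for an unallocated variable can be added, with any content.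
fresh-points-valid : LEM → ∀ x y → Valid (¬' alloc x ⇒ (((x ↪ y) ∧' size≡ 1) -⊛ ⊤'))
fresh-points-valid lem x y = ⇒-valid (¬' alloc x) (((x ↪ y) ∧' size≡ 1) -⊛ ⊤')
  λ s h ¬allocated → -⊛⊤-intro s h [ s x ↦ s y ] ((x ↪ y) ∧' size≡ 1)
    (fresh-cell h (s x) (s y) (¬alloc⇒free s h x ¬allocated))
    (↦-at (s x) (s y) , ↦-size≡1 lem s (s x) (s y))

-- (18) Likewise, with content above the values of X, so pointing to none of them.
fresh-alloc-valid : LEM → ∀ x X →
  Valid (¬' alloc x ⇒ ((alloc x ∧' size≡ 1 ∧' ⋀ (mapL (λ y → ¬' (x ↪ y)) X)) -⊛ ⊤'))
fresh-alloc-valid lem x X = ⇒-valid (¬' alloc x) (cell -⊛ ⊤') λ s h ¬allocated →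
  let v = suc (maxVal s X)
  in -⊛⊤-intro s h [ s x ↦ v ] cell (fresh-cell h (s x) v (¬alloc⇒free s h x ¬allocated))
       (↦-alloc s x v , ↦-size≡1 lem s (s x) v ,
        ⋀-intro s [ s x ↦ v ] (λ y → ¬' (x ↪ y)) X
          (All.map (λ sy≢v → ↦-¬points s x _ v sy≢v) (above-maxVal s X ≤-refl)))
  where
  cell : Form
  cell = alloc x ∧' size≡ 1 ∧' ⋀ (mapL (λ y → ¬' (x ↪ y)) X)

mp-valid : LEM → ∀ φ ψ → Valid φ → Valid (φ ⇒ ψ) → Valid ψ
mp-valid lem φ ψ valid-φ valid-⇒ s h = ⇒-elim lem φ ψ valid-⇒ s h (valid-φ s h)

∗-mono-valid : LEM → ∀ φ ψ χ → Valid (φ ⇒ χ) → Valid ((φ ∗ ψ) ⇒ (χ ∗ ψ))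
∗-mono-valid lem φ ψ χ valid = ⇒-valid (φ ∗ ψ) (χ ∗ ψ) λ s h (h₁ , h₂ , d , h≈ , p , q) →
  h₁ , h₂ , d , h≈ , ⇒-elim lem φ χ valid s h₁ p , q

curry-valid : LEM → ∀ φ ψ χ → Valid ((φ ∗ ψ) ⇒ χ) → Valid (φ ⇒ (ψ -∗ χ))
curry-valid lem φ ψ χ valid = ⇒-valid φ (ψ -∗ χ) λ s h p h₁ h' d h'≈ q →
  ⇒-elim lem (φ ∗ ψ) χ valid s h' (h , h₁ , d , h'≈ , p , q)

uncurry-valid : LEM → ∀ φ ψ χ → Valid (φ ⇒ (ψ -∗ χ)) → Valid ((φ ∗ ψ) ⇒ χ)
uncurry-valid lem φ ψ χ valid = ⇒-valid (φ ∗ ψ) χ λ s h (h₁ , h₂ , d , h≈ , p , q) →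
  ⇒-elim lem φ (ψ -∗ χ) valid s h₁ p h₂ h d h≈ q

lemma3p1 : (lem : (P : Set) → P ⊎ ¬ P) → (φ : Form) → ⊢ φ → Valid φ
lemma3p1 lem _ (taut p σ tautological) = tautology-valid lem p σ tautological
lemma3p1 lem _ (mp {φ} {ψ} ⊢φ ⊢φ⇒ψ)    = mp-valid lem φ ψ (lemma3p1 lem _ ⊢φ) (lemma3p1 lem _ ⊢φ⇒ψ)
lemma3p1 lem _ (ax1 x)                 = λ s h → refl
lemma3p1 lem _ (ax2 φ x y)             = rename-valid φ x y
lemma3p1 lem _ (ax3 x y)               = points⇒alloc-valid x y
lemma3p1 lem _ (ax4 x y z)             = points-functional-valid x y z
lemma3p1 lem _ (ax5 φ ψ)               = ⇔-valid (φ ∗ ψ) (ψ ∗ φ) (∗-comm φ ψ) (∗-comm ψ φ)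
lemma3p1 lem _ (ax6 φ ψ χ)             =
  ⇔-valid ((φ ∗ ψ) ∗ χ) (φ ∗ (ψ ∗ χ)) (∗-assocˡ φ ψ χ) (∗-assocʳ φ ψ χ)
lemma3p1 lem _ (ax7 φ)                 = ⇔-valid φ (φ ∗ emp) (∗-emp-intro φ) (∗-emp-elim φ)
lemma3p1 lem _ (ax8 x)                 = alloc-∗-alloc-valid x
lemma3p1 lem _ (ax9 ξ atom)            = atom-∗⊤-valid ξ atom
lemma3p1 lem _ (ax10 x)                = ¬alloc-∗-valid x
lemma3p1 lem _ (ax11 x y)              = alloc-¬points-∗⊤-valid x y
lemma3p1 lem _ (ax12 x)                = alloc-cell-valid lem x
lemma3p1 lem _ ax13                    = nonempty-cell-valid lem
lemma3p1 lem _ (ax14 β₁ β₂)            = size-subadditive-valid lem β₁ β₂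
lemma3p1 lem _ (ax15 x y)              = two-alloc-valid x y
lemma3p1 lem _ (ax16 X)                = fresh-cell-valid lem X
lemma3p1 lem _ (ax17 x y)              = fresh-points-valid lem x y
lemma3p1 lem _ (ax18 x X)              = fresh-alloc-valid lem x X
lemma3p1 lem _ (∗-mono {φ} {ψ} {χ} d)  = ∗-mono-valid lem φ ψ χ (lemma3p1 lem _ d)
lemma3p1 lem _ (curry {φ} {ψ} {χ} d)   = curry-valid lem φ ψ χ (lemma3p1 lem _ d)
lemma3p1 lem _ (uncurry {φ} {ψ} {χ} d) = uncurry-valid lem φ ψ χ (lemma3p1 lem _ d)
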